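{- Let $B_1$ be a Keedwell Sudoku board and $g\in G_9$. If $B_2=g\cdot B_1$ is also a Keedwell board, then $g\in G_k$.
   Context: A Sudoku board is a $9\times 9$ grid with nine symbols such that each row, column and designated $3\times 3$ block (subsquare) contains each symbol once; subsquares are indexed $(i,j)$, $i,j\in\{0,1,2\}$, with $(0,0)$ the upper-left one. For a $3\times 3$ array, let $\alpha$ be the operator cyclically shifting its rows down by one, and $\beta$ the operator cyclically shifting its columns right by one. A Sudoku board $B$ with upper-left subsquare $K$ is Keedwell if there are exponents $c_{ij},d_{ij}\in\mathbb{Z}/3\mathbb{Z}$ with $c_{00}=d_{00}=0$ such that the $(i,j)$ subsquare of $B$ equals $\alpha^{c_{ij}}\beta^{d_{ij}}K$ for all $i,j$. Let $H_9$ be the group of cell permutations generated by permutations of bands (rows of blocks), permutations of pillars (columns of blocks), permutations of rows within a band, permutations of columns within a pillar, and transpose; let $S_9$ be the group of all relabelings (permutations of the nine symbols, applied to every entry); $G_9=H_9\times S_9$ is the full Sudoku symmetry group. $G_k$ is the largest subgroup of $G_9$ all of whose elements map Keedwell boards to Keedwell boards. -}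

module Defs where

open import Data.Nat using (ℕ; zero; suc)
open import Data.Fin using (Fin; zero; suc; toℕ)
open import Data.Fin.Permutation using (Permutation′; _⟨$⟩ʳ_)
open import Data.Product using (Σ; _×_; _,_; ∃; proj₁; proj₂)
open import Relation.Binary.PropositionalEquality using (_≡_)
open import Relation.Nullary using (Dec; yes; no)
open import Data.Fin using (_≟_)

-- ℤ/3ℤ is represented by Fin 3.
-- A row (resp. column) index of the 9×9 grid is a pair (block index, offset),
-- i.e. row 3*i + a is represented by (i , a), i, a ∈ Fin 3.
Pos : Set
Pos = Fin 3 × Fin 3

Cell : Set
Cell = Pos × Pos

Symbol : Set
Symbol = Fin 9

Grid : Set
Grid = Cell → Symbol

EachOnce : {I : Set} → (I → Symbol) → Set
EachOnce {I} f = (∀ (s : Symbol) → ∃ λ (x : I) → f x ≡ s)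
               × (∀ (x y : I) → f x ≡ f y → x ≡ y)

IsSudoku : Grid → Set
IsSudoku B =
    (∀ (r : Pos) → EachOnce (λ (c : Pos) → B (r , c)))
  × (∀ (c : Pos) → EachOnce (λ (r : Pos) → B (r , c)))
  × (∀ (i j : Fin 3) → EachOnce (λ (ab : Fin 3 × Fin 3) →
                          B ((i , proj₁ ab) , (j , proj₂ ab))))

Array3 : Set
Array3 = Fin 3 → Fin 3 → Symbol

pred3 : Fin 3 → Fin 3
pred3 zero = suc (suc zero)
pred3 (suc zero) = zero
pred3 (suc (suc zero)) = suc zero

α : Array3 → Array3
α K a b = K (pred3 a) b

β : Array3 → Array3
β K a b = K a (pred3 b)

iter : {A : Set} → ℕ → (A → A) → A → A
iter zero f x = x
iter (suc n) f x = f (iter n f x)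

α^ : Fin 3 → Array3 → Array3
α^ c = iter (toℕ c) α

β^ : Fin 3 → Array3 → Array3
β^ d = iter (toℕ d) β

subsquare : Grid → Fin 3 → Fin 3 → Array3
subsquare B i j a b = B ((i , a) , (j , b))

IsKeedwell : Grid → Set
IsKeedwell B =
  IsSudoku B ×
  (Σ (Fin 3 → Fin 3 → Fin 3) λ c → Σ (Fin 3 → Fin 3 → Fin 3) λ d →
     (c zero zero ≡ zero) × (d zero zero ≡ zero) ×
     (∀ (i j a b : Fin 3) →
        subsquare B i j a b ≡ α^ (c i j) (β^ (d i j) (subsquare B zero zero)) a b))

atIndex : Fin 3 → Permutation′ 3 → Fin 3 → Fin 3 → Fin 3
atIndex k σ i a with i ≟ k
... | yes _ = σ ⟨$⟩ʳ a
... | no _  = a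

bandPerm : Permutation′ 3 → Cell → Cell
bandPerm σ ((i , a) , c) = ((σ ⟨$⟩ʳ i , a) , c)

pillarPerm : Permutation′ 3 → Cell → Cell
pillarPerm σ (r , (j , b)) = (r , (σ ⟨$⟩ʳ j , b))

rowPermInBand : Fin 3 → Permutation′ 3 → Cell → Cell
rowPermInBand k σ ((i , a) , c) = ((i , atIndex k σ i a) , c)

colPermInPillar : Fin 3 → Permutation′ 3 → Cell → Cell
colPermInPillar k σ (r , (j , b)) = (r , (j , atIndex k σ j b))

transpose : Cell → Cell
transpose (r , c) = (c , r)

-- H₉ : the cell permutations generated by the above (closure under identity
-- and composition; since all generators have finite order / inverses among
-- the generators, this is the generated group).
data InH9 : (Cell → Cell) → Set where
  gen-band   : ∀ σ → InH9 (bandPerm σ)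
  gen-pillar : ∀ σ → InH9 (pillarPerm σ)
  gen-row    : ∀ k σ → InH9 (rowPermInBand k σ)
  gen-col    : ∀ k σ → InH9 (colPermInPillar k σ)
  gen-transp : InH9 transpose
  h-id       : InH9 (λ x → x)
  h-comp     : ∀ {f g} → InH9 f → InH9 g → InH9 (λ x → f (g x))
  h-ext      : ∀ {f g} → InH9 f → (∀ x → f x ≡ g x) → InH9 g

-- Action of g = (h , π) ∈ G₉ = H₉ × S₉ on a grid: move cells by h, relabel by π.
act : (Cell → Cell) → Permutation′ 9 → Grid → Grid
act h π B x = π ⟨$⟩ʳ B (h x)

PreservesKeedwell : (Cell → Cell) → Permutation′ 9 → Set
PreservesKeedwell h π = ∀ (B : Grid) → IsKeedwell B → IsKeedwell (act h π B)

-- G_k : the largest subgroup of G₉ all of whose elements preserve Keedwell boards.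
-- The set of Keedwell-preserving elements of G₉ contains the identity and is
-- closed under composition, hence (G₉ finite) is a subgroup; so it is G_k.
InGk : (Cell → Cell) → Permutation′ 9 → Set
InGk h π = InH9 h × PreservesKeedwell h π

-- Every element of H₉ is, up to a transpose, a product of a row map and a column map, each
-- permuting the bands (pillars) and the rows (columns) inside each band (pillar). Write
-- ρᵢ : ℤ/3ℤ → ℤ/3ℤ for the row permutation inside band i. Comparing cell ((i, a), (0, 0)) of
-- B₁ and of g·B₁, both Keedwell, and using that the (0,0) subsquare of B₁ is a Latin square,
-- gives ρᵢ = t ∘ ρ₀ ∘ t′ for translations t, t′ of ℤ/3ℤ; likewise for columns. Since the
-- translations form a normal subgroup of Sym(ℤ/3ℤ), this condition, which no longer mentions
-- B₁, carries the shift pattern of any Keedwell board B over to B ∘ h. Transposition and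
-- relabelling preserve Keedwell boards, which handles the remaining parts of g.
module Submission where

open import Defs
open import Data.Bool using (Bool; true; false; not)
open import Data.Nat using (ℕ; zero; suc)
open import Data.Fin using (Fin; zero; suc; toℕ; _≟_)
open import Data.Fin.Properties using (all?; any?)
open import Data.Fin.Permutation
  using (Permutation′; _⟨$⟩ʳ_; _⟨$⟩ˡ_; inverseʳ; inverseˡ; id; flip; _∘ₚ_)
open import Data.Product using (_,_; proj₁; proj₂; ∃; ∃₂)
open import Data.Product.Algebra using (×-comm)
open import Data.Product.Function.Dependent.Propositional using (Σ-↔)
open import Data.Product.Function.NonDependent.Propositional using (_×-↔_)
open import Function.Base using (_∘_)
open import Function.Bundles using (Inverse; Injection; _↔_)
open import Function.Definitions using (Injective)
open import Function.Properties.Inverse using (↔⇒↣)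
open import Relation.Nullary using (yes; no)
open import Relation.Nullary.Decidable using (toWitness; _→-dec_)
open import Relation.Binary.PropositionalEquality hiding (J)

open Inverse using (to; from; strictlyInverseˡ)

private
  variable
    n : ℕ
    I J : Set
    B B₁ : Grid

-- shift c a = a − c in ℤ/3ℤ
shift : Fin 3 → Fin 3 → Fin 3
shift c = iter (toℕ c) pred3

neg : Fin 3 → Fin 3
neg zero = zero
neg (suc zero) = suc (suc zero)
neg (suc (suc zero)) = suc zero

_⊕_ : Fin 3 → Fin 3 → Fin 3
c ⊕ d = shift (neg c) d

shift-⊕ : ∀ c d a → shift c (shift d a) ≡ shift (c ⊕ d) a
shift-⊕ = toWitness {a? = all? λ c → all? λ d → all? λ a → shift c (shift d a) ≟ shift (c ⊕ d) a} _

shift-neg-inverseˡ : ∀ c a → shift (neg c) (shift c a) ≡ a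
shift-neg-inverseˡ = toWitness {a? = all? λ c → all? λ a → shift (neg c) (shift c a) ≟ a} _

shift-neg-inverseʳ : ∀ c a → shift c (shift (neg c) a) ≡ a
shift-neg-inverseʳ = toWitness {a? = all? λ c → all? λ a → shift c (shift (neg c) a) ≟ a} _

shift-injective : ∀ c {a b} → shift c a ≡ shift c b → a ≡ b
shift-injective c {a} {b} eq = begin
  a                          ≡⟨ shift-neg-inverseˡ c a ⟨
  shift (neg c) (shift c a)  ≡⟨ cong (shift (neg c)) eq ⟩
  shift (neg c) (shift c b)  ≡⟨ shift-neg-inverseˡ c b ⟩
  b                          ∎
  where open ≡-Reasoning

shift-fixes-zero⇒zero : ∀ w → shift w zero ≡ zero → w ≡ zero
shift-fixes-zero⇒zero zero             _  = refl
shift-fixes-zero⇒zero (suc zero)       ()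
shift-fixes-zero⇒zero (suc (suc zero)) ()

shift-conjugate : (g : Fin 3 → Fin 3) → Injective _≡_ _≡_ g →
                  ∀ k → ∃ λ v → ∀ a → shift k (g a) ≡ g (shift v a)
shift-conjugate g g-inj k =
  let v , conj = via-table (g zero) (g (suc zero)) (g (suc (suc zero)))
                   (λ a b eq → g-inj (trans (g≗table a) (trans eq (sym (g≗table b))))) k
  in v , λ a → subst₂ (λ x y → shift k x ≡ y)
                  (sym (g≗table a)) (sym (g≗table (shift v a))) (conj a)
  where
  table : Fin 3 → Fin 3 → Fin 3 → Fin 3 → Fin 3
  table x y z zero = x
  table x y z (suc zero) = y
  table x y z (suc (suc zero)) = z

  g≗table : ∀ a → g a ≡ table (g zero) (g (suc zero)) (g (suc (suc zero))) a
  g≗table zero = refl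
  g≗table (suc zero) = refl
  g≗table (suc (suc zero)) = refl

  -- a function on Fin 3 is its table of three values, so this is decided by evaluation
  via-table : ∀ x y z → (∀ a b → table x y z a ≡ table x y z b → a ≡ b) →
              ∀ k → ∃ λ v → ∀ a → shift k (table x y z a) ≡ table x y z (shift v a)
  via-table = toWitness {a? = all? λ x → all? λ y → all? λ z →
    (all? λ a → all? λ b → (table x y z a ≟ table x y z b) →-dec (a ≟ b)) →-dec
    (all? λ k → any? λ v → all? λ a → shift k (table x y z a) ≟ table x y z (shift v a))} _

_≈ₛ_ : (f g : Fin 3 → Fin 3) → Set
f ≈ₛ g = ∃₂ λ k u → ∀ a → f a ≡ shift k (g (shift u a))

≈ₛ-shiftˡ : ∀ e {f g} → f ≈ₛ g → (shift e ∘ f) ≈ₛ g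
≈ₛ-shiftˡ e {f} {g} (k , u , f≡) = e ⊕ k , u , λ a → begin
  shift e (f a)                      ≡⟨ cong (shift e) (f≡ a) ⟩
  shift e (shift k (g (shift u a)))  ≡⟨ shift-⊕ e k _ ⟩
  shift (e ⊕ k) (g (shift u a))      ∎
  where open ≡-Reasoning

≈ₛ-unshiftˡ : ∀ e {f g} → (shift e ∘ f) ≈ₛ g → f ≈ₛ g
≈ₛ-unshiftˡ e {f} {g} ef≈g =
  let k , u , f≡ = ≈ₛ-shiftˡ (neg e) {g = g} ef≈g
  in k , u , λ a → trans (sym (shift-neg-inverseˡ e (f a))) (f≡ a)

-- By normality, the left translation in f ≈ₛ g can be prescribed arbitrarily.
≈ₛ-realign : ∀ {f g} → Injective _≡_ _≡_ g → f ≈ₛ g →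
             ∀ E → ∃ λ w → ∀ a → f a ≡ shift E (g (shift w a))
≈ₛ-realign {f} {g} g-inj (k , u , f≡) E =
  let v , conj = shift-conjugate g g-inj (neg E ⊕ k)
  in v ⊕ u , λ a → begin
    f a                                          ≡⟨ f≡ a ⟩
    shift k (g (shift u a))                      ≡⟨ shift-neg-inverseʳ E _ ⟨
    shift E (shift (neg E) (shift k (g _)))      ≡⟨ cong (shift E) (shift-⊕ (neg E) k _) ⟩
    shift E (shift (neg E ⊕ k) (g (shift u a)))  ≡⟨ cong (shift E) (conj _) ⟩
    shift E (g (shift v (shift u a)))            ≡⟨ cong (shift E ∘ g) (shift-⊕ v u a) ⟩
    shift E (g (shift (v ⊕ u) a))                ∎
  where open ≡-Reasoning

⟨$⟩ʳ-injective : (π : Permutation′ n) → Injective _≡_ _≡_ (π ⟨$⟩ʳ_)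
⟨$⟩ʳ-injective π = Injection.injective (↔⇒↣ π)

EachOnce-reindex : (e : J ↔ I) {f : I → Symbol} → EachOnce f → EachOnce (f ∘ to e)
EachOnce-reindex e {f} (onto , inj) =
  (λ s → let x , fx≡s = onto s in from e x , trans (cong f (strictlyInverseˡ e x)) fx≡s) ,
  (λ x y fx≡fy → Injection.injective (↔⇒↣ e) (inj _ _ fx≡fy))

EachOnce-relabel : (π : Permutation′ 9) {f : I → Symbol} →
                   EachOnce f → EachOnce (λ x → π ⟨$⟩ʳ f x)
EachOnce-relabel π (onto , inj) =
  (λ s → let x , fx≡ = onto (π ⟨$⟩ˡ s) in x , trans (cong (π ⟨$⟩ʳ_) fx≡) (inverseʳ π)) ,
  (λ x y eq → inj x y (⟨$⟩ʳ-injective π eq))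

EachOnce-resp-≗ : {f g : I → Symbol} → f ≗ g → EachOnce f → EachOnce g
EachOnce-resp-≗ f≗g (onto , inj) =
  (λ s → let x , fx≡s = onto s in x , trans (sym (f≗g x)) fx≡s) ,
  (λ x y eq → inj x y (trans (f≗g x) (trans eq (sym (f≗g y)))))

record ShiftPattern (B : Grid) : Set where
  field
    rowShift colShift : Fin 3 → Fin 3 → Fin 3
    rowShift₀₀ : rowShift zero zero ≡ zero
    colShift₀₀ : colShift zero zero ≡ zero
    reduce : ∀ i j a b → B ((i , a) , (j , b)) ≡
                         B ((zero , shift (rowShift i j) a) , (zero , shift (colShift i j) b))

iter-comm : {A : Set} (f : A → A) → ∀ n x → iter n f (f x) ≡ f (iter n f x)
iter-comm f zero    x = refl
iter-comm f (suc n) x = cong f (iter-comm f n x)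

iter-α : ∀ n (K : Array3) a b → iter n α K a b ≡ K (iter n pred3 a) b
iter-α zero    K a b = refl
iter-α (suc n) K a b = trans (iter-α n K (pred3 a) b) (cong (λ x → K x b) (iter-comm pred3 n a))

iter-β : ∀ n (K : Array3) a b → iter n β K a b ≡ K a (iter n pred3 b)
iter-β zero    K a b = refl
iter-β (suc n) K a b = trans (iter-β n K a (pred3 b)) (cong (K a) (iter-comm pred3 n b))

α^β^-shift : ∀ c d (K : Array3) a b → α^ c (β^ d K) a b ≡ K (shift c a) (shift d b)
α^β^-shift c d K a b = trans (iter-α (toℕ c) (β^ d K) a b) (iter-β (toℕ d) K (shift c a) b)

shiftPattern : IsKeedwell B → ShiftPattern B
shiftPattern (_ , c , d , c₀₀ , d₀₀ , subsquares) = record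
  { rowShift = c ; colShift = d ; rowShift₀₀ = c₀₀ ; colShift₀₀ = d₀₀
  ; reduce = λ i j a b → trans (subsquares i j a b) (α^β^-shift (c i j) (d i j) _ a b) }

isKeedwell : IsSudoku B → ShiftPattern B → IsKeedwell B
isKeedwell sudoku p = sudoku , rowShift , colShift , rowShift₀₀ , colShift₀₀ ,
  λ i j a b → trans (reduce i j a b) (sym (α^β^-shift (rowShift i j) (colShift i j) _ a b))
  where open ShiftPattern p

block₀₀-injective : IsSudoku B → ∀ {a b a′ b′} →
                    B ((zero , a) , (zero , b)) ≡ B ((zero , a′) , (zero , b′)) →
                    (a , b) ≡ (a′ , b′)
block₀₀-injective (_ , _ , squares) = proj₂ (squares zero zero) _ _

keedwell-resp-≗ : ∀ {B B′} → B ≗ B′ → IsKeedwell B → IsKeedwell B′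
keedwell-resp-≗ {B} {B′} B≗B′ k@((rows , cols , squares) , _) = isKeedwell
  ( (λ r → EachOnce-resp-≗ (λ _ → B≗B′ _) (rows r))
  , (λ c → EachOnce-resp-≗ (λ _ → B≗B′ _) (cols c))
  , (λ i j → EachOnce-resp-≗ (λ _ → B≗B′ _) (squares i j)) )
  (record { ShiftPattern p hiding (reduce)
          ; reduce = λ i j a b → trans (sym (B≗B′ _)) (trans (reduce i j a b) (B≗B′ _)) })
  where
  p = shiftPattern k
  open ShiftPattern p

keedwell-relabel : (π : Permutation′ 9) → IsKeedwell B → IsKeedwell (λ x → π ⟨$⟩ʳ B x)
keedwell-relabel π k@((rows , cols , squares) , _) = isKeedwell
  ( (λ r → EachOnce-relabel π (rows r))
  , (λ c → EachOnce-relabel π (cols c))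
  , (λ i j → EachOnce-relabel π (squares i j)) )
  (record { ShiftPattern p hiding (reduce)
          ; reduce = λ i j a b → cong (π ⟨$⟩ʳ_) (reduce i j a b) })
  where
  p = shiftPattern k
  open ShiftPattern p

keedwell-unrelabel : (π : Permutation′ 9) → IsKeedwell (λ x → π ⟨$⟩ʳ B x) → IsKeedwell B
keedwell-unrelabel π k = keedwell-resp-≗ (λ _ → inverseˡ π) (keedwell-relabel (flip π) k)

keedwell-transpose : IsKeedwell B → IsKeedwell (B ∘ transpose)
keedwell-transpose k@((rows , cols , squares) , _) = isKeedwell
  (cols , rows , λ i j → EachOnce-reindex (×-comm _ _) (squares j i))
  (record
    { rowShift = λ i j → colShift j i ; colShift = λ i j → rowShift j i
    ; rowShift₀₀ = colShift₀₀ ; colShift₀₀ = rowShift₀₀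
    ; reduce = λ i j a b → reduce j i b a })
  where open ShiftPattern (shiftPattern k)

transposeIf : Bool → Cell → Cell
transposeIf false = λ x → x
transposeIf true  = transpose

keedwell-transposeIf : ∀ t → IsKeedwell B → IsKeedwell (B ∘ transposeIf t)
keedwell-transposeIf false k = k
keedwell-transposeIf true  k = keedwell-transpose k

record BlockPerm : Set where
  constructor blockPerm
  field
    blocks : Permutation′ 3
    within : Fin 3 → Permutation′ 3
open BlockPerm

⟦_⟧ : BlockPerm → Pos ↔ Pos
⟦ blockPerm σ ρ ⟧ = Σ-↔ σ (λ {i} → ρ i)

gridMap : BlockPerm → BlockPerm → Cell → Cell
gridMap R C (r , c) = (to ⟦ R ⟧ r , to ⟦ C ⟧ c)

sudoku-gridMap : ∀ R C → IsSudoku B → IsSudoku (B ∘ gridMap R C)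
sudoku-gridMap R C (rows , cols , squares) =
  (λ r → EachOnce-reindex ⟦ C ⟧ (rows (to ⟦ R ⟧ r))) ,
  (λ c → EachOnce-reindex ⟦ R ⟧ (cols (to ⟦ C ⟧ c))) ,
  (λ i j → EachOnce-reindex (within R i ×-↔ within C j)
              (squares (blocks R ⟨$⟩ʳ i) (blocks C ⟨$⟩ʳ j)))

rows-linked : ∀ R C → IsKeedwell B₁ → IsKeedwell (B₁ ∘ gridMap R C) →
              ∀ i → (within R i ⟨$⟩ʳ_) ≈ₛ (within R zero ⟨$⟩ʳ_)
rows-linked {B₁} R C k₁ k i =
  ≈ₛ-unshiftˡ (rowShift₁ (σ i) (τ zero)) {g = ρ₀}
    (rowShift₁ (σ zero) (τ zero) , rowShift i zero , λ a →
      -- both sides reduce into the (0,0) subsquare of B₁, where a symbol determines its cell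
      cong proj₁ (block₀₀-injective (proj₁ k₁) (begin
        B₁ ((zero , _) , (zero , _))                ≡⟨ reduce₁ _ _ _ _ ⟨
        B₁ (gridMap R C ((i , a) , (zero , zero)))  ≡⟨ reduce i zero a zero ⟩
        B₁ (gridMap R C ((zero , _) , (zero , _)))  ≡⟨ reduce₁ _ _ _ _ ⟩
        B₁ ((zero , _) , (zero , _))                ∎)))
  where
  open ≡-Reasoning
  open ShiftPattern (shiftPattern k)
  open ShiftPattern (shiftPattern k₁) renaming (rowShift to rowShift₁; reduce to reduce₁)
  σ = blocks R ⟨$⟩ʳ_
  τ = blocks C ⟨$⟩ʳ_
  ρ₀ = within R zero ⟨$⟩ʳ_

cols-linked : ∀ R C → IsKeedwell B₁ → IsKeedwell (B₁ ∘ gridMap R C) →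
              ∀ j → (within C j ⟨$⟩ʳ_) ≈ₛ (within C zero ⟨$⟩ʳ_)
cols-linked R C k₁ k = rows-linked C R (keedwell-transpose k₁) (keedwell-transpose k)

shift-absorbed⇒zero : ∀ {g} E w → Injective _≡_ _≡_ g →
                       (∀ a → shift E (g a) ≡ shift E (g (shift w a))) → w ≡ zero
shift-absorbed⇒zero E w g-inj eq =
  shift-fixes-zero⇒zero w (sym (g-inj (shift-injective E (eq zero))))

shiftPattern-gridMap : ∀ R C →
  (∀ i → (within R i ⟨$⟩ʳ_) ≈ₛ (within R zero ⟨$⟩ʳ_)) →
  (∀ j → (within C j ⟨$⟩ʳ_) ≈ₛ (within C zero ⟨$⟩ʳ_)) →
  ShiftPattern B → ShiftPattern (B ∘ gridMap R C)
shiftPattern-gridMap {B} R C rows≈ cols≈ p = record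
  { rowShift = λ i j → proj₁ (rowAlign i j)
  ; colShift = λ i j → proj₁ (colAlign i j)
  ; rowShift₀₀ = shift-absorbed⇒zero (rowShift (σ zero) (τ zero)) _
                   (⟨$⟩ʳ-injective (within R zero)) (proj₂ (rowAlign zero zero))
  ; colShift₀₀ = shift-absorbed⇒zero (colShift (σ zero) (τ zero)) _
                   (⟨$⟩ʳ-injective (within C zero)) (proj₂ (colAlign zero zero))
  ; reduce = λ i j a b → begin
      B (gridMap R C ((i , a) , (j , b)))
        ≡⟨ reduce (σ i) (τ j) _ _ ⟩
      B ((zero , shift (rowShift (σ i) (τ j)) (ρ i a)) ,
         (zero , shift (colShift (σ i) (τ j)) (ρ′ j b)))
        ≡⟨ cong₂ (λ x y → B ((zero , x) , (zero , y)))
                 (proj₂ (rowAlign i j) a) (proj₂ (colAlign i j) b) ⟩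
      B ((zero , shift (rowShift (σ zero) (τ zero)) (ρ zero _)) ,
         (zero , shift (colShift (σ zero) (τ zero)) (ρ′ zero _)))
        ≡⟨ reduce (σ zero) (τ zero) _ _ ⟨
      B (gridMap R C ((zero , _) , (zero , _)))
        ∎ }
  where
  open ≡-Reasoning
  open ShiftPattern p
  σ = blocks R ⟨$⟩ʳ_
  τ = blocks C ⟨$⟩ʳ_
  ρ ρ′ : Fin 3 → Fin 3 → Fin 3
  ρ i = within R i ⟨$⟩ʳ_
  ρ′ j = within C j ⟨$⟩ʳ_

  rowAlign : ∀ i j → ∃ λ w → ∀ a → shift (rowShift (σ i) (τ j)) (ρ i a) ≡
                                    shift (rowShift (σ zero) (τ zero)) (ρ zero (shift w a))
  rowAlign i j = ≈ₛ-realign (⟨$⟩ʳ-injective (within R zero))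
                   (≈ₛ-shiftˡ (rowShift (σ i) (τ j)) {g = ρ zero} (rows≈ i))
                   (rowShift (σ zero) (τ zero))

  colAlign : ∀ i j → ∃ λ w → ∀ b → shift (colShift (σ i) (τ j)) (ρ′ j b) ≡
                                    shift (colShift (σ zero) (τ zero)) (ρ′ zero (shift w b))
  colAlign i j = ≈ₛ-realign (⟨$⟩ʳ-injective (within C zero))
                   (≈ₛ-shiftˡ (colShift (σ i) (τ j)) {g = ρ′ zero} (cols≈ j))
                   (colShift (σ zero) (τ zero))

keedwell-gridMap : ∀ R C → IsKeedwell B₁ → IsKeedwell (B₁ ∘ gridMap R C) →
                   IsKeedwell B → IsKeedwell (B ∘ gridMap R C)
keedwell-gridMap R C k₁ k₁′ k = isKeedwell (sudoku-gridMap R C (proj₁ k))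
  (shiftPattern-gridMap R C (rows-linked R C k₁ k₁′) (cols-linked R C k₁ k₁′) (shiftPattern k))

idᵇ : BlockPerm
idᵇ = blockPerm id (λ _ → id)

_∘ᵇ_ : BlockPerm → BlockPerm → BlockPerm
R₁ ∘ᵇ R₂ = blockPerm (blocks R₂ ∘ₚ blocks R₁)
                     (λ i → within R₂ i ∘ₚ within R₁ (blocks R₂ ⟨$⟩ʳ i))

permAt : Fin 3 → Permutation′ 3 → Fin 3 → Permutation′ 3
permAt k σ i with i ≟ k
... | yes _ = σ
... | no  _ = id

atIndex≡permAt : ∀ k σ i a → atIndex k σ i a ≡ permAt k σ i ⟨$⟩ʳ a
atIndex≡permAt k σ i a with i ≟ k
... | yes _ = refl
... | no  _ = refl

transposeIf-transpose : ∀ t x → transposeIf t (transpose x) ≡ transposeIf (not t) x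
transposeIf-transpose false x = refl
transposeIf-transpose true  x = refl

record BlockForm (h : Cell → Cell) : Set where
  constructor blockForm
  field
    transposed : Bool
    rowPerm colPerm : BlockPerm
    form : h ≗ transposeIf transposed ∘ gridMap rowPerm colPerm

blockForm-∘ : ∀ {f g} → BlockForm f → BlockForm g → BlockForm (f ∘ g)
blockForm-∘ {f} (blockForm t R₁ C₁ f≗) (blockForm false R₂ C₂ g≗) =
  blockForm t (R₁ ∘ᵇ R₂) (C₁ ∘ᵇ C₂) λ x → trans (cong f (g≗ x)) (f≗ _)
blockForm-∘ {f} (blockForm t R₁ C₁ f≗) (blockForm true R₂ C₂ g≗) =
  blockForm (not t) (C₁ ∘ᵇ R₂) (R₁ ∘ᵇ C₂) λ x →
    trans (cong f (g≗ x)) (trans (f≗ _) (transposeIf-transpose t _))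

InH9⇒blockForm : ∀ {h} → InH9 h → BlockForm h
InH9⇒blockForm (gen-band σ)   = blockForm false (blockPerm σ (λ _ → id)) idᵇ λ _ → refl
InH9⇒blockForm (gen-pillar σ) = blockForm false idᵇ (blockPerm σ (λ _ → id)) λ _ → refl
InH9⇒blockForm (gen-row k σ)  = blockForm false (blockPerm id (permAt k σ)) idᵇ
  λ { ((i , a) , c) → cong (λ a′ → ((i , a′) , c)) (atIndex≡permAt k σ i a) }
InH9⇒blockForm (gen-col k σ)  = blockForm false idᵇ (blockPerm id (permAt k σ))
  λ { (r , (j , b)) → cong (λ b′ → (r , (j , b′))) (atIndex≡permAt k σ j b) }
InH9⇒blockForm gen-transp     = blockForm true idᵇ idᵇ λ _ → refl
InH9⇒blockForm h-id           = blockForm false idᵇ idᵇ λ _ → refl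
InH9⇒blockForm (h-comp f∈H g∈H) = blockForm-∘ (InH9⇒blockForm f∈H) (InH9⇒blockForm g∈H)
InH9⇒blockForm (h-ext f∈H f≗g) =
  let blockForm t R C f≗ = InH9⇒blockForm f∈H
  in blockForm t R C λ x → trans (sym (f≗g x)) (f≗ x)

lemma3 : (B₁ : Grid) → IsKeedwell B₁ →
    (h : Cell → Cell) → InH9 h → (π : Permutation′ 9) →
    IsKeedwell (act h π B₁) → InGk h π
lemma3 B₁ k₁ h h∈H π k₂ = h∈H , preserves
  where
  open BlockForm (InH9⇒blockForm h∈H)

  k₁′ : IsKeedwell ((B₁ ∘ transposeIf transposed) ∘ gridMap rowPerm colPerm)
  k₁′ = keedwell-resp-≗ (cong B₁ ∘ form) (keedwell-unrelabel π k₂)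

  preserves : PreservesKeedwell h π
  preserves B k = keedwell-relabel π (keedwell-resp-≗ (cong B ∘ sym ∘ form)
    (keedwell-gridMap rowPerm colPerm
      (keedwell-transposeIf transposed k₁) k₁′ (keedwell-transposeIf transposed k)))
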